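{- Let $\Delta \ge 4$ be an integer and let $c_1,\dots,c_\Delta$ be the real numbers defined by $c_\Delta=\frac{1}{\Delta}$ and $ic_{i}+c_{i+1}=1$ for $i=1,\dots,\Delta-1$. Then: (a) $\frac{1}{i+1}<c_i=\frac{1}{i+1}+\frac{c_{i+2}}{i(i+1)}$ for $1\le i\le \Delta -2$, and $c_i<\frac{i+1}{i(i+2)}$ for $1\le i\le \Delta -3$; (b) $c_{i+1}<c_i$ for $i=1,\dots,\Delta -2$; (c) if $1\le i\le \Delta-2$ and $i\equiv \Delta \pmod 2$, then $$c_{i}=\frac{1}{i+1}+\sum_{j=1}^{\frac{\Delta-i-2}{2}}\frac{i+2j}{i(i+1)\cdots (i+2j+1)}+\frac{1}{i(i+1)\cdots \Delta};$$ (d) if $1\le i\le \Delta-3$ and $i\equiv \Delta-1 \pmod 2$, then $$c_i=\frac{1}{i+1}+\sum_{j=1}^{\frac{\Delta-i-3}{2}}\frac{i+2j}{i(i+1)\cdots (i+2j+1)}+\frac{\Delta-1}{i(i+1)\cdots \Delta}.$$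
   Context: An empty sum is $0$. -}

module Defs where

open import Data.Nat using (ℕ; zero; suc; _+_; _*_)
open import Data.Integer using (ℤ)
open import Data.Rational using (ℚ; 0ℚ; _/_) renaming (_+_ to _+ℚ_)

-- frac p d = p / d as a rational; convention frac p 0 = 0
-- (only ever used with nonzero denominators).
frac : ℤ → ℕ → ℚ
frac p zero = 0ℚ
frac p (suc d) = p / suc d

-- rprod i k = i (i+1) ... (i+k)
rprod : ℕ → ℕ → ℕ
rprod i zero = i
rprod i (suc k) = rprod i k * (i + suc k)

sumFrom1 : ℕ → (ℕ → ℚ) → ℚ
sumFrom1 zero f = 0ℚ
sumFrom1 (suc n) f = sumFrom1 n f +ℚ f (suc n)

-- Eliminating c (i+1) from two consecutive equations i c_i + c_(i+1) = 1 gives the two-step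
-- recurrence c_i = 1/(i+1) + c_(i+2) / (i(i+1)).  Since c_Δ = c_(Δ-1) = 1/Δ, downward induction
-- along it makes every c_i positive; then c_i = (1 - c_(i+1))/i < 1/i, and (a), (b) follow from the
-- recurrence.  Unrolling the recurrence m times from a fixed i gives 1/(i+1), the first m summands
-- of (c)/(d), and the tail c_(i+2m+2) / (i(i+1)...(i+2m+1)); the parity of Δ - i decides whether
-- the unrolling stops at c_Δ (giving (c)) or at c_(Δ-1) (giving (d)).
module Submission where

open import Defs
open import Data.Nat using (ℕ; suc; _∸_; _%_; ⌊_/2⌋) renaming (_+_ to _+ℕ_; _*_ to _*ℕ_; _≤_ to _≤ℕ_; _<_ to _<ℕ_)
open import Data.Integer using (+_)
open import Data.Rational using (ℚ; 1ℚ; _+_; _*_; _<_)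
open import Data.Product using (_×_)
open import Relation.Binary.PropositionalEquality using (_≡_)

open import Data.Nat using (s≤s; z≤n)
import Data.Nat.Properties as ℕ
open import Data.Nat.Tactic.RingSolver using () renaming (solve-∀ to ℕ-solve-∀)
open import Data.Integer using () renaming (_+_ to _+ℤ_)
import Data.Integer.Properties as ℤ
open import Data.Rational using (0ℚ; _-_; _/_; fromℚᵘ; positive)
import Data.Rational.Properties as ℚ
open import Data.Rational.Unnormalised using (mkℚᵘ; *≡*) renaming (_+_ to _+ᵘ_; _*_ to _*ᵘ_)
import Data.Rational.Unnormalised.Properties as ℚᵘ
open import Data.Product using (_,_)
open import Relation.Nullary.Decidable using (dec⇒maybe)
open import Relation.Binary.PropositionalEquality using (refl; sym; trans; cong; cong₂; subst; module ≡-Reasoning)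
open import Tactic.RingSolver using (solve-∀)
open import Tactic.RingSolver.Core.AlmostCommutativeRing using (AlmostCommutativeRing; fromCommutativeRing)

open ≡-Reasoning

ℚ-ring : AlmostCommutativeRing _ _
ℚ-ring = fromCommutativeRing ℚ.+-*-commutativeRing (λ x → dec⇒maybe (0ℚ ℚ.≟ x))

linear-solution : ∀ {a s x y} → s * a ≡ 1ℚ → a * x + y ≡ 1ℚ → x ≡ s * (1ℚ - y)
linear-solution {a} {s} {x} {y} s*a≡1 a*x+y≡1 = begin
  x                        ≡⟨ sym (ℚ.*-identityˡ x) ⟩
  1ℚ * x                   ≡⟨ cong (_* x) (sym s*a≡1) ⟩
  s * a * x                ≡⟨ regroup s a x y ⟩
  s * ((a * x + y) - y)    ≡⟨ cong (λ u → s * (u - y)) a*x+y≡1 ⟩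
  s * (1ℚ - y)             ∎
  where
  regroup : ∀ s a x y → s * a * x ≡ s * ((a * x + y) - y)
  regroup = solve-∀ ℚ-ring

p<p+q : ∀ {p q} → 0ℚ < q → p < p + q
p<p+q {p} q>0 = subst (_< p + _) (ℚ.+-identityʳ p) (ℚ.+-monoʳ-< p q>0)

+-pos : ∀ {p q} → 0ℚ < p → 0ℚ < q → 0ℚ < p + q
+-pos {p} {q} p>0 q>0 = subst (_< p + q) (ℚ.+-identityˡ 0ℚ) (ℚ.+-mono-< p>0 q>0)

*-pos : ∀ {p q} → 0ℚ < p → 0ℚ < q → 0ℚ < p * q
*-pos {p} {q} p>0 q>0 = subst (_< p * q) (ℚ.*-zeroˡ q) (ℚ.*-monoˡ-<-pos q {{positive q>0}} p>0)

*[1-q]<p : ∀ {p q} → 0ℚ < p → 0ℚ < q → p * (1ℚ - q) < p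
*[1-q]<p {p} {q} p>0 q>0 = subst (p * (1ℚ - q) <_) (split p q) (p<p+q (*-pos p>0 q>0))
  where
  split : ∀ p q → p * (1ℚ - q) + p * q ≡ p
  split = solve-∀ ℚ-ring

-- frac (+ p) (suc a) unfolds to fromℚᵘ (mkℚᵘ (+ p) a), so arithmetic on frac is done in ℚᵘ.
fromℚᵘ-homo-* : ∀ p q → fromℚᵘ (p *ᵘ q) ≡ fromℚᵘ p * fromℚᵘ q
fromℚᵘ-homo-* p q = ℚ.toℚᵘ-injective (ℚᵘ.≃-trans (ℚ.toℚᵘ-fromℚᵘ (p *ᵘ q))
  (ℚᵘ.≃-trans (ℚᵘ.*-cong (ℚᵘ.≃-sym (ℚ.toℚᵘ-fromℚᵘ p)) (ℚᵘ.≃-sym (ℚ.toℚᵘ-fromℚᵘ q)))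
              (ℚᵘ.≃-sym (ℚ.toℚᵘ-homo-* (fromℚᵘ p) (fromℚᵘ q)))))

fromℚᵘ-homo-+ : ∀ p q → fromℚᵘ (p +ᵘ q) ≡ fromℚᵘ p + fromℚᵘ q
fromℚᵘ-homo-+ p q = ℚ.toℚᵘ-injective (ℚᵘ.≃-trans (ℚ.toℚᵘ-fromℚᵘ (p +ᵘ q))
  (ℚᵘ.≃-trans (ℚᵘ.+-cong (ℚᵘ.≃-sym (ℚ.toℚᵘ-fromℚᵘ p)) (ℚᵘ.≃-sym (ℚ.toℚᵘ-fromℚᵘ q)))
              (ℚᵘ.≃-sym (ℚ.toℚᵘ-homo-+ (fromℚᵘ p) (fromℚᵘ q)))))

frac-* : ∀ p q {m n} → 1 ≤ℕ m → 1 ≤ℕ n → frac (+ p) m * frac (+ q) n ≡ frac (+ (p *ℕ q)) (m *ℕ n)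
frac-* p q {suc a} {suc b} _ _ = trans (sym (fromℚᵘ-homo-* (mkℚᵘ (+ p) a) (mkℚᵘ (+ q) b)))
  (cong (_/ (suc a *ℕ suc b)) (sym (ℤ.pos-* p q)))

frac-+ : ∀ p q {m n} → 1 ≤ℕ m → 1 ≤ℕ n → frac (+ p) m + frac (+ q) n ≡ frac (+ (p *ℕ n +ℕ q *ℕ m)) (m *ℕ n)
frac-+ p q {suc a} {suc b} _ _ = trans (sym (fromℚᵘ-homo-+ (mkℚᵘ (+ p) a) (mkℚᵘ (+ q) b)))
  (cong (_/ (suc a *ℕ suc b))
    (trans (cong₂ _+ℤ_ (sym (ℤ.pos-* p (suc b))) (sym (ℤ.pos-* q (suc a))))
           (sym (ℤ.pos-+ (p *ℕ suc b) (q *ℕ suc a)))))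

frac-cross : ∀ p q {m n} → 1 ≤ℕ m → 1 ≤ℕ n → p *ℕ n ≡ q *ℕ m → frac (+ p) m ≡ frac (+ q) n
frac-cross p q {suc a} {suc b} _ _ p*n≡q*m = ℚ.fromℚᵘ-cong {mkℚᵘ (+ p) a} {mkℚᵘ (+ q) b}
  (*≡* (trans (sym (ℤ.pos-* p (suc b))) (trans (cong +_ p*n≡q*m) (ℤ.pos-* q (suc a)))))

frac-pos : ∀ n → 1 ≤ℕ n → 0ℚ < frac (+ 1) n
frac-pos (suc a) _ = ℚ.positive⁻¹ _ {{ℚ.normalize-pos 1 (suc a)}}

frac-inverse : ∀ n → 1 ≤ℕ n → frac (+ 1) n * frac (+ n) 1 ≡ 1ℚ
frac-inverse n 1≤n = trans (frac-* 1 n 1≤n (s≤s z≤n))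
  (frac-cross (1 *ℕ n) 1 (ℕ.*-mono-≤ 1≤n (s≤s z≤n)) (s≤s z≤n) (cross n))
  where
  cross : ∀ n → 1 *ℕ n *ℕ 1 ≡ 1 *ℕ (n *ℕ 1)
  cross = ℕ-solve-∀

frac-suc : ∀ n → frac (+ suc n) 1 ≡ frac (+ n) 1 + 1ℚ
frac-suc n = sym (trans (frac-+ n 1 (s≤s z≤n) (s≤s z≤n)) (cong (λ k → frac (+ k) 1) (normalise n)))
  where
  normalise : ∀ n → n *ℕ 1 +ℕ 1 ≡ suc n
  normalise = ℕ-solve-∀

frac-complement : ∀ n → 1 ≤ℕ n → frac (+ 1) n * (1ℚ - frac (+ 1) (suc n)) ≡ frac (+ 1) (suc n)
frac-complement n 1≤n = sym (linear-solution {a} {frac (+ 1) n} {t} {t} (frac-inverse n 1≤n) (begin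
  a * t + t          ≡⟨ factor a t ⟩
  t * (a + 1ℚ)       ≡⟨ cong (t *_) (sym (frac-suc n)) ⟩
  t * frac (+ suc n) 1  ≡⟨ frac-inverse (suc n) (s≤s z≤n) ⟩
  1ℚ                 ∎))
  where
  a = frac (+ n) 1
  t = frac (+ 1) (suc n)
  factor : ∀ a t → a * t + t ≡ t * (a + 1ℚ)
  factor = solve-∀ ℚ-ring

1≤rprod : ∀ {i} k → 1 ≤ℕ i → 1 ≤ℕ rprod i k
1≤rprod 0 1≤i = 1≤i
1≤rprod {i} (suc k) 1≤i = ℕ.*-mono-≤ (1≤rprod k 1≤i) (ℕ.≤-trans 1≤i (ℕ.m≤m+n i (suc k)))

rprod-suc-suc : ∀ i k → rprod i (suc (suc k)) ≡ rprod i k *ℕ (i +ℕ suc k) *ℕ suc (i +ℕ suc k)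
rprod-suc-suc i k = cong (rprod i k *ℕ (i +ℕ suc k) *ℕ_) (ℕ.+-suc i (suc k))

-- _%_ peels off two successors at a time, so the cases i ≥ 2 reduce definitionally to i - 2.
even-gap : ∀ i d → i % 2 ≡ (i +ℕ (2 +ℕ d)) % 2 → 2 *ℕ ⌊ d /2⌋ ≡ d
even-gap 0 0 _ = refl
even-gap 0 1 ()
even-gap 0 (suc (suc d)) h = trans (ℕ.*-suc 2 ⌊ d /2⌋) (cong (2 +ℕ_) (even-gap 0 d h))
even-gap 1 0 _ = refl
even-gap 1 1 ()
even-gap 1 (suc (suc d)) h = trans (ℕ.*-suc 2 ⌊ d /2⌋) (cong (2 +ℕ_) (even-gap 1 d h))
even-gap (suc (suc i)) d h = even-gap i d h

≤∸⇒+≤ : ∀ {i k Δ} → 1 ≤ℕ i → i ≤ℕ Δ ∸ k → i +ℕ k ≤ℕ Δ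
≤∸⇒+≤ {i} {k} {Δ} 1≤i i≤Δ∸k = ℕ.m≤o∸n⇒m+n≤o i k≤Δ i≤Δ∸k
  where
  k≤Δ : k ≤ℕ Δ
  k≤Δ = ℕ.<⇒≤ (ℕ.m∸n≢0⇒n<m (ℕ.m<n⇒n≢0 (ℕ.≤-trans 1≤i i≤Δ∸k)))

∸-split : ∀ {i k Δ} → 1 ≤ℕ i → i ≤ℕ Δ ∸ k → i +ℕ (k +ℕ (Δ ∸ i ∸ k)) ≡ Δ
∸-split {i} {k} {Δ} 1≤i i≤Δ∸k = begin
  i +ℕ (k +ℕ (Δ ∸ i ∸ k))   ≡⟨ sym (ℕ.+-assoc i k _) ⟩
  i +ℕ k +ℕ (Δ ∸ i ∸ k)     ≡⟨ cong (i +ℕ k +ℕ_) (ℕ.∸-+-assoc Δ i k) ⟩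
  i +ℕ k +ℕ (Δ ∸ (i +ℕ k))  ≡⟨ ℕ.m+[n∸m]≡n (≤∸⇒+≤ 1≤i i≤Δ∸k) ⟩
  Δ                         ∎

frac-*-expand : ∀ {t r} → 1 ≤ℕ t → 1 ≤ℕ r →
  frac (+ 1) (suc t) * frac (+ 1) r ≡ frac (+ t) (r *ℕ t *ℕ suc t)
frac-*-expand {t} {r} 1≤t 1≤r = trans (frac-* 1 1 {suc t} (s≤s z≤n) 1≤r)
  (frac-cross 1 t (ℕ.*-mono-≤ {1} {suc t} (s≤s z≤n) 1≤r) (ℕ.*-mono-≤ (ℕ.*-mono-≤ 1≤r 1≤t) (s≤s z≤n)) (cross t r))
  where
  cross : ∀ t r → 1 *ℕ (r *ℕ t *ℕ suc t) ≡ t *ℕ (suc t *ℕ r)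
  cross = ℕ-solve-∀

summand : ℕ → ℕ → ℚ
summand i j = frac (+ (i +ℕ 2 *ℕ j)) (rprod i (2 *ℕ j +ℕ 1))

module Recurrence (Δ : ℕ) (c : ℕ → ℚ) (c-top : c Δ ≡ frac (+ 1) Δ)
  (c-rec : ∀ i → 1 ≤ℕ i → i <ℕ Δ → frac (+ i) 1 * c i + c (suc i) ≡ 1ℚ) where

  c-linear : ∀ {k} → 1 ≤ℕ k → k <ℕ Δ → c k ≡ frac (+ 1) k * (1ℚ - c (suc k))
  c-linear {k} 1≤k k<Δ = linear-solution {frac (+ k) 1} {frac (+ 1) k} (frac-inverse k 1≤k) (c-rec k 1≤k k<Δ)

  c-penultimate : ∀ {k} → 1 ≤ℕ k → suc k ≡ Δ → c k ≡ frac (+ 1) Δ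
  c-penultimate {k} 1≤k refl = begin
    c k                                          ≡⟨ c-linear 1≤k ℕ.≤-refl ⟩
    frac (+ 1) k * (1ℚ - c (suc k))              ≡⟨ cong (λ y → frac (+ 1) k * (1ℚ - y)) c-top ⟩
    frac (+ 1) k * (1ℚ - frac (+ 1) (suc k))     ≡⟨ frac-complement k 1≤k ⟩
    frac (+ 1) (suc k)                           ∎

  c-step : ∀ {i} → 1 ≤ℕ i → i +ℕ 2 ≤ℕ Δ →
           c i ≡ frac (+ 1) (suc i) + c (i +ℕ 2) * frac (+ 1) (i *ℕ suc i)
  c-step {i} 1≤i i+2≤Δ = begin
    c i                                  ≡⟨ c-linear 1≤i (ℕ.≤-trans (ℕ.n≤1+n (suc i)) 2+i≤Δ) ⟩
    s * (1ℚ - c (suc i))                 ≡⟨ cong (λ y → s * (1ℚ - y)) (c-linear (s≤s z≤n) 2+i≤Δ) ⟩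
    s * (1ℚ - t * (1ℚ - c (2 +ℕ i)))     ≡⟨ expand s t (c (2 +ℕ i)) ⟩
    s * (1ℚ - t) + c (2 +ℕ i) * (s * t)  ≡⟨ cong₂ _+_ (frac-complement i 1≤i)
                                              (cong₂ _*_ (cong c (ℕ.+-comm 2 i)) (frac-* 1 1 1≤i (s≤s z≤n))) ⟩
    t + c (i +ℕ 2) * frac (+ 1) (i *ℕ suc i)  ∎
    where
    s = frac (+ 1) i
    t = frac (+ 1) (suc i)
    2+i≤Δ : 2 +ℕ i ≤ℕ Δ
    2+i≤Δ = subst (_≤ℕ Δ) (ℕ.+-comm i 2) i+2≤Δ
    expand : ∀ s t z → s * (1ℚ - t * (1ℚ - z)) ≡ s * (1ℚ - t) + z * (s * t)
    expand = solve-∀ ℚ-ring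

  c-pos : ∀ {k} → 1 ≤ℕ k → k ≤ℕ Δ → 0ℚ < c k
  c-pos {k} 1≤k k≤Δ = downward (Δ ∸ k) 1≤k (ℕ.m∸n+n≡m k≤Δ)
    where
    downward : ∀ n {k} → 1 ≤ℕ k → n +ℕ k ≡ Δ → 0ℚ < c k
    downward 0 {k} 1≤k refl = subst (0ℚ <_) (sym c-top) (frac-pos k 1≤k)
    downward 1 {k} 1≤k refl = subst (0ℚ <_) (sym (c-penultimate 1≤k refl)) (frac-pos (suc k) (s≤s z≤n))
    downward (suc (suc n)) {k} 1≤k refl = subst (0ℚ <_) (sym (c-step 1≤k k+2≤Δ))
      (+-pos (frac-pos (suc k) (s≤s z≤n))
             (*-pos (downward n (ℕ.≤-trans 1≤k (ℕ.m≤m+n k 2)) (reassoc n k))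
                    (frac-pos (k *ℕ suc k) (ℕ.*-mono-≤ 1≤k (s≤s z≤n)))))
      where
      k+2≤Δ : k +ℕ 2 ≤ℕ suc (suc (n +ℕ k))
      k+2≤Δ = subst (_≤ℕ suc (suc (n +ℕ k))) (ℕ.+-comm 2 k) (s≤s (s≤s (ℕ.m≤n+m k n)))
      reassoc : ∀ n k → n +ℕ (k +ℕ 2) ≡ suc (suc (n +ℕ k))
      reassoc = ℕ-solve-∀

  c<1/k : ∀ {k} → 1 ≤ℕ k → k <ℕ Δ → c k < frac (+ 1) k
  c<1/k {k} 1≤k k<Δ = subst (_< frac (+ 1) k) (sym (c-linear 1≤k k<Δ))
    (*[1-q]<p (frac-pos k 1≤k) (c-pos (s≤s z≤n) k<Δ))

  1/[1+i]<c : ∀ {i} → 1 ≤ℕ i → i +ℕ 2 ≤ℕ Δ → frac (+ 1) (suc i) < c i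
  1/[1+i]<c {i} 1≤i i+2≤Δ = subst (frac (+ 1) (suc i) <_) (sym (c-step 1≤i i+2≤Δ))
    (p<p+q (*-pos (c-pos (ℕ.≤-trans 1≤i (ℕ.m≤m+n i 2)) i+2≤Δ) (frac-pos (i *ℕ suc i) (ℕ.*-mono-≤ 1≤i (s≤s z≤n)))))

  c-decreasing : ∀ {i} → 1 ≤ℕ i → i +ℕ 2 ≤ℕ Δ → c (suc i) < c i
  c-decreasing {i} 1≤i i+2≤Δ =
    ℚ.<-trans (c<1/k (s≤s z≤n) (subst (_≤ℕ Δ) (ℕ.+-comm i 2) i+2≤Δ)) (1/[1+i]<c 1≤i i+2≤Δ)

  c<[1+i]/[i*[i+2]] : ∀ {i} → 1 ≤ℕ i → i +ℕ 3 ≤ℕ Δ → c i < frac (+ suc i) (i *ℕ (i +ℕ 2))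
  c<[1+i]/[i*[i+2]] {i} 1≤i i+3≤Δ = subst (c i <_) simplify
    (subst (_< t + frac (+ 1) (i +ℕ 2) * v) (sym (c-step 1≤i (ℕ.≤-trans (ℕ.n≤1+n (i +ℕ 2)) i+2<Δ)))
      (ℚ.+-monoʳ-< t (ℚ.*-monoˡ-<-pos v {{positive (frac-pos (i *ℕ suc i) 1≤i*[1+i])}} (c<1/k 1≤i+2 i+2<Δ))))
    where
    t = frac (+ 1) (suc i)
    v = frac (+ 1) (i *ℕ suc i)
    1≤i+2 : 1 ≤ℕ i +ℕ 2
    1≤i+2 = ℕ.≤-trans 1≤i (ℕ.m≤m+n i 2)
    1≤i*[1+i] : 1 ≤ℕ i *ℕ suc i
    1≤i*[1+i] = ℕ.*-mono-≤ 1≤i (s≤s z≤n)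
    i+2<Δ : i +ℕ 2 <ℕ Δ
    i+2<Δ = subst (_≤ℕ Δ) (ℕ.+-suc i 2) i+3≤Δ
    d = (i +ℕ 2) *ℕ (i *ℕ suc i)
    1≤d : 1 ≤ℕ d
    1≤d = ℕ.*-mono-≤ 1≤i+2 1≤i*[1+i]
    cross : ∀ i → (1 *ℕ ((i +ℕ 2) *ℕ (i *ℕ suc i)) +ℕ 1 *ℕ suc i) *ℕ (i *ℕ (i +ℕ 2))
                  ≡ suc i *ℕ (suc i *ℕ ((i +ℕ 2) *ℕ (i *ℕ suc i)))
    cross = ℕ-solve-∀
    simplify : t + frac (+ 1) (i +ℕ 2) * v ≡ frac (+ suc i) (i *ℕ (i +ℕ 2))
    simplify = begin
      t + frac (+ 1) (i +ℕ 2) * v             ≡⟨ cong (λ x → t + x) (frac-* 1 1 1≤i+2 1≤i*[1+i]) ⟩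
      t + frac (+ 1) d                        ≡⟨ frac-+ 1 1 {suc i} (s≤s z≤n) 1≤d ⟩
      frac (+ (1 *ℕ d +ℕ 1 *ℕ suc i)) (suc i *ℕ d)
        ≡⟨ frac-cross _ (suc i) (ℕ.*-mono-≤ {1} {suc i} (s≤s z≤n) 1≤d) (ℕ.*-mono-≤ 1≤i 1≤i+2) (cross i) ⟩
      frac (+ suc i) (i *ℕ (i +ℕ 2))          ∎

  c-unroll : ∀ m {i} → 1 ≤ℕ i → i +ℕ (2 +ℕ 2 *ℕ m) ≤ℕ Δ →
    c i ≡ frac (+ 1) (suc i) + sumFrom1 m (summand i)
          + c (i +ℕ (2 +ℕ 2 *ℕ m)) * frac (+ 1) (rprod i (suc (2 *ℕ m)))
  c-unroll 0 {i} 1≤i i+2≤Δ = begin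
    c i                                                     ≡⟨ c-step 1≤i i+2≤Δ ⟩
    frac (+ 1) (suc i) + c (i +ℕ 2) * frac (+ 1) (i *ℕ suc i)
      ≡⟨ cong₂ _+_ (sym (ℚ.+-identityʳ (frac (+ 1) (suc i)))) (cong (λ n → c (i +ℕ 2) * frac (+ 1) (i *ℕ n)) (ℕ.+-comm 1 i)) ⟩
    frac (+ 1) (suc i) + 0ℚ + c (i +ℕ 2) * frac (+ 1) (rprod i 1)  ∎
  c-unroll (suc m) {i} 1≤i t′≤Δ = begin
    c i                                               ≡⟨ c-unroll m 1≤i (ℕ.≤-trans t≤t′ t′≤Δ) ⟩
    a + S + c t * frac (+ 1) r                        ≡⟨ cong (λ x → a + S + x * frac (+ 1) r) (c-step 1≤t t+2≤Δ) ⟩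
    a + S + (frac (+ 1) (suc t) + c (t +ℕ 2) * frac (+ 1) (t *ℕ suc t)) * frac (+ 1) r
      ≡⟨ regroup a S (frac (+ 1) (suc t)) (c (t +ℕ 2)) (frac (+ 1) (t *ℕ suc t)) (frac (+ 1) r) ⟩
    a + (S + frac (+ 1) (suc t) * frac (+ 1) r) + c (t +ℕ 2) * (frac (+ 1) (t *ℕ suc t) * frac (+ 1) r)
      ≡⟨ cong₂ (λ x y → a + (S + x) + y) next-summand (cong₂ _*_ (cong c t+2≡t′) next-weight) ⟩
    a + (S + summand i (suc m)) + c t′ * frac (+ 1) (rprod i (suc (2 *ℕ suc m)))  ∎
    where
    a = frac (+ 1) (suc i)
    S = sumFrom1 m (summand i)
    t = i +ℕ (2 +ℕ 2 *ℕ m)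
    t′ = i +ℕ (2 +ℕ 2 *ℕ suc m)
    r = rprod i (suc (2 *ℕ m))
    regroup : ∀ a S x z u v → a + S + (x + z * u) * v ≡ a + (S + x * v) + z * (u * v)
    regroup = solve-∀ ℚ-ring
    t+2≡t′ : t +ℕ 2 ≡ t′
    t+2≡t′ = reassoc i m
      where
      reassoc : ∀ i m → i +ℕ (2 +ℕ 2 *ℕ m) +ℕ 2 ≡ i +ℕ (2 +ℕ 2 *ℕ suc m)
      reassoc = ℕ-solve-∀
    t≤t′ : t ≤ℕ t′
    t≤t′ = subst (t ≤ℕ_) t+2≡t′ (ℕ.m≤m+n t 2)
    t+2≤Δ : t +ℕ 2 ≤ℕ Δ
    t+2≤Δ = subst (_≤ℕ Δ) (sym t+2≡t′) t′≤Δ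
    1≤t : 1 ≤ℕ t
    1≤t = ℕ.≤-trans 1≤i (ℕ.m≤m+n i _)
    1≤r : 1 ≤ℕ r
    1≤r = 1≤rprod (suc (2 *ℕ m)) 1≤i
    r′≡r*t*[1+t] : rprod i (suc (2 *ℕ suc m)) ≡ r *ℕ t *ℕ suc t
    r′≡r*t*[1+t] = trans (cong (λ k → rprod i (suc k)) (ℕ.*-suc 2 m)) (rprod-suc-suc i (suc (2 *ℕ m)))
    next-summand : frac (+ 1) (suc t) * frac (+ 1) r ≡ summand i (suc m)
    next-summand = trans (frac-*-expand 1≤t 1≤r)
      (cong₂ (λ p q → frac (+ p) q) (sym (reassoc i m))
             (sym (trans (cong (rprod i) (ℕ.+-comm (2 *ℕ suc m) 1)) r′≡r*t*[1+t])))
      where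
      reassoc : ∀ i m → i +ℕ 2 *ℕ suc m ≡ i +ℕ (2 +ℕ 2 *ℕ m)
      reassoc = ℕ-solve-∀
    next-weight : frac (+ 1) (t *ℕ suc t) * frac (+ 1) r ≡ frac (+ 1) (rprod i (suc (2 *ℕ suc m)))
    next-weight = trans (frac-* 1 1 (ℕ.*-mono-≤ 1≤t (s≤s z≤n)) 1≤r)
      (cong (frac (+ 1)) (trans (reorder t r) (sym r′≡r*t*[1+t])))
      where
      reorder : ∀ t r → t *ℕ suc t *ℕ r ≡ r *ℕ t *ℕ suc t
      reorder = ℕ-solve-∀

  c-closed-form-even : ∀ i → 1 ≤ℕ i → i ≤ℕ Δ ∸ 2 → i % 2 ≡ Δ % 2 →
    c i ≡ frac (+ 1) (suc i) + sumFrom1 ⌊ Δ ∸ i ∸ 2 /2⌋ (summand i) + frac (+ 1) (rprod i (Δ ∸ i))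
  c-closed-form-even i 1≤i i≤Δ∸2 i≡Δ = begin
    c i                                ≡⟨ c-unroll m 1≤i (ℕ.≤-reflexive t≡Δ) ⟩
    a + S + c t * frac (+ 1) r         ≡⟨ cong (λ x → a + S + x * frac (+ 1) r) (trans (cong c t≡Δ) c-top) ⟩
    a + S + frac (+ 1) Δ * frac (+ 1) r  ≡⟨ cong (λ x → a + S + x) tail ⟩
    a + S + frac (+ 1) (rprod i (Δ ∸ i))  ∎
    where
    d = Δ ∸ i ∸ 2
    m = ⌊ d /2⌋
    a = frac (+ 1) (suc i)
    S = sumFrom1 m (summand i)
    t = i +ℕ (2 +ℕ 2 *ℕ m)
    r = rprod i (suc (2 *ℕ m))
    split : i +ℕ (2 +ℕ d) ≡ Δ
    split = ∸-split {k = 2} 1≤i i≤Δ∸2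
    t≡Δ : t ≡ Δ
    t≡Δ = trans (cong (λ e → i +ℕ (2 +ℕ e)) (even-gap i d (trans i≡Δ (cong (_% 2) (sym split))))) split
    Δ∸i≡ : Δ ∸ i ≡ 2 +ℕ 2 *ℕ m
    Δ∸i≡ = trans (cong (_∸ i) (sym t≡Δ)) (ℕ.m+n∸m≡n i _)
    tail : frac (+ 1) Δ * frac (+ 1) r ≡ frac (+ 1) (rprod i (Δ ∸ i))
    tail = begin
      frac (+ 1) Δ * frac (+ 1) r   ≡⟨ frac-* 1 1 (subst (1 ≤ℕ_) t≡Δ (ℕ.≤-trans 1≤i (ℕ.m≤m+n i _))) (1≤rprod (suc (2 *ℕ m)) 1≤i) ⟩
      frac (+ 1) (Δ *ℕ r)           ≡⟨ cong (frac (+ 1)) (trans (ℕ.*-comm Δ r) (cong (r *ℕ_) (sym t≡Δ))) ⟩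
      frac (+ 1) (rprod i (2 +ℕ 2 *ℕ m))  ≡⟨ cong (λ k → frac (+ 1) (rprod i k)) (sym Δ∸i≡) ⟩
      frac (+ 1) (rprod i (Δ ∸ i))  ∎

  c-closed-form-odd : ∀ i → 1 ≤ℕ i → i ≤ℕ Δ ∸ 3 → i % 2 ≡ (Δ ∸ 1) % 2 →
    c i ≡ frac (+ 1) (suc i) + sumFrom1 ⌊ Δ ∸ i ∸ 3 /2⌋ (summand i) + frac (+ (Δ ∸ 1)) (rprod i (Δ ∸ i))
  c-closed-form-odd i 1≤i i≤Δ∸3 i≡Δ-1 = begin
    c i                                  ≡⟨ c-unroll m 1≤i t≤Δ ⟩
    a + S + c t * frac (+ 1) r           ≡⟨ cong (λ x → a + S + x * frac (+ 1) r) (c-penultimate 1≤t 1+t≡Δ) ⟩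
    a + S + frac (+ 1) Δ * frac (+ 1) r  ≡⟨ cong (λ x → a + S + x) tail ⟩
    a + S + frac (+ (Δ ∸ 1)) (rprod i (Δ ∸ i))  ∎
    where
    d = Δ ∸ i ∸ 3
    m = ⌊ d /2⌋
    a = frac (+ 1) (suc i)
    S = sumFrom1 m (summand i)
    t = i +ℕ (2 +ℕ 2 *ℕ m)
    r = rprod i (suc (2 *ℕ m))
    split : i +ℕ (3 +ℕ d) ≡ Δ
    split = ∸-split {k = 3} 1≤i i≤Δ∸3
    Δ∸1≡ : Δ ∸ 1 ≡ i +ℕ (2 +ℕ d)
    Δ∸1≡ = cong (_∸ 1) (trans (sym split) (ℕ.+-suc i (2 +ℕ d)))
    i+3+2m≡Δ : i +ℕ (3 +ℕ 2 *ℕ m) ≡ Δ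
    i+3+2m≡Δ = trans (cong (λ e → i +ℕ (3 +ℕ e)) (even-gap i d (trans i≡Δ-1 (cong (_% 2) Δ∸1≡)))) split
    1+t≡Δ : suc t ≡ Δ
    1+t≡Δ = trans (sym (ℕ.+-suc i (2 +ℕ 2 *ℕ m))) i+3+2m≡Δ
    t≤Δ : t ≤ℕ Δ
    t≤Δ = subst (t ≤ℕ_) 1+t≡Δ (ℕ.n≤1+n t)
    1≤t : 1 ≤ℕ t
    1≤t = ℕ.≤-trans 1≤i (ℕ.m≤m+n i _)
    tail : frac (+ 1) Δ * frac (+ 1) r ≡ frac (+ (Δ ∸ 1)) (rprod i (Δ ∸ i))
    tail = begin
      frac (+ 1) Δ * frac (+ 1) r            ≡⟨ cong (λ x → frac (+ 1) x * frac (+ 1) r) (sym 1+t≡Δ) ⟩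
      frac (+ 1) (suc t) * frac (+ 1) r      ≡⟨ frac-*-expand 1≤t (1≤rprod (suc (2 *ℕ m)) 1≤i) ⟩
      frac (+ t) (r *ℕ t *ℕ suc t)           ≡⟨ cong (frac (+ t)) (sym (rprod-suc-suc i (suc (2 *ℕ m)))) ⟩
      frac (+ t) (rprod i (3 +ℕ 2 *ℕ m))
        ≡⟨ cong₂ (λ p k → frac (+ p) (rprod i k)) (cong (_∸ 1) 1+t≡Δ)
                 (sym (trans (cong (_∸ i) (sym i+3+2m≡Δ)) (ℕ.m+n∸m≡n i _))) ⟩
      frac (+ (Δ ∸ 1)) (rprod i (Δ ∸ i))     ∎

lemma1 : (Δ : ℕ) → 4 ≤ℕ Δ → (c : ℕ → ℚ) →
    c Δ ≡ frac (+ 1) Δ →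
    (∀ i → 1 ≤ℕ i → i <ℕ Δ → frac (+ i) 1 * c i + c (suc i) ≡ 1ℚ) →
    ((∀ i → 1 ≤ℕ i → i ≤ℕ Δ ∸ 2 →
        (frac (+ 1) (suc i) < c i)
        × (c i ≡ frac (+ 1) (suc i) + c (i +ℕ 2) * frac (+ 1) (i *ℕ suc i)))
     × (∀ i → 1 ≤ℕ i → i ≤ℕ Δ ∸ 3 → c i < frac (+ suc i) (i *ℕ (i +ℕ 2))))
    × (∀ i → 1 ≤ℕ i → i ≤ℕ Δ ∸ 2 → c (suc i) < c i)
    × (∀ i → 1 ≤ℕ i → i ≤ℕ Δ ∸ 2 → i % 2 ≡ Δ % 2 →
        c i ≡ frac (+ 1) (suc i)
              + sumFrom1 ⌊ Δ ∸ i ∸ 2 /2⌋ (λ j → frac (+ (i +ℕ 2 *ℕ j)) (rprod i (2 *ℕ j +ℕ 1)))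
              + frac (+ 1) (rprod i (Δ ∸ i)))
    × (∀ i → 1 ≤ℕ i → i ≤ℕ Δ ∸ 3 → i % 2 ≡ (Δ ∸ 1) % 2 →
        c i ≡ frac (+ 1) (suc i)
              + sumFrom1 ⌊ Δ ∸ i ∸ 3 /2⌋ (λ j → frac (+ (i +ℕ 2 *ℕ j)) (rprod i (2 *ℕ j +ℕ 1)))
              + frac (+ (Δ ∸ 1)) (rprod i (Δ ∸ i)))
lemma1 Δ _ c c-top c-rec =
  ( (λ i 1≤i i≤Δ∸2 → 1/[1+i]<c 1≤i (≤∸⇒+≤ 1≤i i≤Δ∸2) , c-step 1≤i (≤∸⇒+≤ 1≤i i≤Δ∸2))
  , (λ i 1≤i i≤Δ∸3 → c<[1+i]/[i*[i+2]] 1≤i (≤∸⇒+≤ 1≤i i≤Δ∸3)) )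
  , (λ i 1≤i i≤Δ∸2 → c-decreasing 1≤i (≤∸⇒+≤ 1≤i i≤Δ∸2))
  , c-closed-form-even
  , c-closed-form-odd
  where
  open Recurrence Δ c c-top c-rec
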